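{- Let $k\ge2$. For every integer $m\ge1$, \[d_0(m,k)=\begin{cases} d_0\!\left(\frac{m-1}{k},k\right)+1, & \text{if } m-1 \text{ is a multiple of } k,\\ 1, & \text{otherwise.}\end{cases}\]
   Context: Fix an integer $k\ge 2$. Let $T_k$ be the infinite rooted $k$-ary tree (every vertex has exactly $k$ children) with one additional self-loop at the root, so every vertex has degree $k+1$. Chip-firing: a vertex with at least $k+1$ chips may fire, sending one chip along each incident edge (a non-root vertex sends one chip to its parent and one to each of its $k$ children; the root sends one chip to each of its $k$ children and one chip to itself along the self-loop). Starting with $N\ge 0$ chips at the root and none elsewhere, vertices fire until no vertex can fire; this terminates, and the number of times each vertex fires does not depend on the order of firings. $f_0(N,k)$ denotes the number of times the root fires (so $f_0(0,k)=0$). Define $g_0(m,k)=f_0(mk,k)$ and $d_0(m,k)=g_0(m+1,k)-g_0(m,k)$ for integers $m\ge0$. -}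

module Defs where

open import Data.Nat using (ℕ; zero; suc; _+_; _∸_; _≤_; _<_)
open import Data.Fin using (Fin)
import Data.Fin.Properties as FinP
open import Data.List using (List; []; _∷_)
import Data.List.Properties as ListP
open import Data.Product using (Σ; ∃; _×_; _,_)
open import Relation.Binary.PropositionalEquality using (_≡_)
open import Relation.Nullary using (Dec; yes; no)
open import Relation.Binary.Definitions using (DecidableEquality)

-- Vertices of the infinite rooted k-ary tree T_k: a vertex is the list of
-- child indices on the path from it back up to the root.
-- root = [] ; the i-th child of v is  i ∷ v ; the parent of  i ∷ v  is v.
Vertex : ℕ → Set
Vertex k = List (Fin k)

root : ∀ {k} → Vertex k
root = []

_≟V_ : ∀ {k} → DecidableEquality (Vertex k)
_≟V_ = ListP.≡-dec FinP._≟_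

Config : ℕ → Set
Config k = Vertex k → ℕ

ind : ∀ {P : Set} → Dec P → ℕ
ind (yes _) = 1
ind (no _)  = 0

isParent : ∀ {k} (w v : Vertex k) → ℕ
isParent w []      = 0
isParent w (i ∷ v) = ind (v ≟V w)

-- number of chips w receives when v fires (one chip along each edge incident to v):
--   one chip to v's parent (if v is not the root),
--   one chip to each of v's k children,
--   one chip to the root itself along the self-loop (if v is the root).
received : ∀ {k} (v w : Vertex k) → ℕ
received v w = isParent w v + isParent v w + selfLoop v w
  where
  selfLoop : ∀ {k} (v w : Vertex k) → ℕ
  selfLoop [] [] = 1
  selfLoop _  _  = 0

fire : ∀ {k} → Config k → Vertex k → Config k
fire {k} c v w with w ≟V v
... | yes _ = (c w ∸ suc k) + received v w
... | no _  = c w + received v w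

data Run {k : ℕ} : Config k → List (Vertex k) → Config k → Set where
  done : ∀ {c} → Run c [] c
  step : ∀ {c v vs c'} → suc k ≤ c v → Run (fire c v) vs c' → Run c (v ∷ vs) c'

Stable : ∀ {k} → Config k → Set
Stable {k} c = ∀ v → c v < suc k

initial : ∀ {k} → ℕ → Config k
initial N []      = N
initial N (_ ∷ _) = 0

rootCount : ∀ {k} → List (Vertex k) → ℕ
rootCount []            = 0
rootCount ([] ∷ vs)     = suc (rootCount vs)
rootCount ((_ ∷ _) ∷ vs) = rootCount vs

-- RootFires k N r : some legal firing sequence from N chips at the root
-- reaches a stable configuration, with the root firing exactly r times.
-- (By the abelian property cited in the paper's context, r is then f_0(N,k).)
RootFires : ℕ → ℕ → ℕ → Set
RootFires k N r =
  Σ (List (Vertex k)) λ vs → Σ (Config k) λ c' →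
    Run (initial N) vs c' × Stable c' × rootCount vs ≡ r

module Submission where

-- By the least action principle, every stabilizing firing sequence from a
-- given configuration fires each vertex equally often: its firing vector is
-- the least one that would leave at most k chips everywhere.  So f₀(N) can be
-- read off one explicit stabilization.  Adding the N chips one at a time keeps
-- the configuration constant on each depth, the depth profile being the
-- bijective base-k expansion of N (digits in 1..k, least significant at the
-- root).  Adding a chip fires whole levels, carrying through the leading
-- digits equal to k, and every carry costs exactly one root firing, because a
-- firing of depth 1 hands k chips back to a root that holds 1.  So the
-- (n+1)-st chip fires the root ν(n) times, ν(n) = carries (digits n) being
-- the number of leading digits k of n.  Hence
-- d₀(m) = ν(mk) + ν(mk + 1) + … + ν(mk + k − 1) = ν(mk) = 1 + ν(m − 1),
-- and ν(m − 1) is ν(jk) = d₀(j) if m − 1 = jk, and 0 if k ∤ m − 1.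

open import Defs
open import Data.Nat using (ℕ; suc; _*_; _∸_; _≤_)
open import Data.Nat.Divisibility using (_∣_)
open import Data.Integer using (ℤ; _⊖_; +_) renaming (_+_ to _+ℤ_)
open import Relation.Binary.PropositionalEquality using (_≡_)
open import Relation.Nullary using (¬_)
open import Data.Product using (_×_)

open import Data.Nat using (zero; _+_; _<_; z≤n; s≤s; _%_; _/_; _≟_)
open import Data.Nat.Properties
open import Data.Nat.DivMod using (m≡m%n+[m/n]*n; m%n<n)
open import Data.Nat.Divisibility using (m%n≡0⇒n∣m)
import Data.Integer.Properties as ℤ
open import Data.Fin using (Fin; punchIn) renaming (zero to fzero; suc to fsuc)
import Data.Fin.Properties as Fin
open import Data.List using (List; []; _∷_; _++_; length; tabulate; concatMap)
import Data.List.Properties as List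
open import Data.List.Relation.Unary.All using (All; []; _∷_)
open import Data.Product using (Σ; _,_; proj₂)
open import Function using (_∘_)
open import Relation.Binary.PropositionalEquality
  using (refl; sym; trans; cong; cong₂; subst; _≗_; _≢_; module ≡-Reasoning)
open import Relation.Nullary using (Dec; yes; no; contradiction)
open import Algebra.Properties.CommutativeMonoid.Sum +-0-commutativeMonoid
  using (sum; sum-syntax; sum-cong-≗; ∑-distrib-+; sum-remove)
open import Algebra.Properties.CommutativeSemigroup +-commutativeSemigroup
  using (interchange; xy∙z≈xz∙y; x∙yz≈xz∙y)

ind-yes : ∀ {P : Set} (d : Dec P) → P → ind d ≡ 1
ind-yes (yes _) _ = refl
ind-yes (no ¬p) p = contradiction p ¬p

ind-no : ∀ {P : Set} (d : Dec P) → ¬ P → ind d ≡ 0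
ind-no (yes p) ¬p = contradiction p ¬p
ind-no (no _)  _  = refl

ind-cong : ∀ {P Q : Set} (d : Dec P) (e : Dec Q) → (P → Q) → (Q → P) → ind d ≡ ind e
ind-cong (yes p) (yes q) _ _ = refl
ind-cong (yes p) (no ¬q) f _ = contradiction (f p) ¬q
ind-cong (no ¬p) (yes q) _ g = contradiction (g q) ¬p
ind-cong (no ¬p) (no ¬q) _ _ = refl

∑-const : ∀ n c → ∑[ j < n ] c ≡ c * n
∑-const zero    c = sym (*-zeroʳ c)
∑-const (suc n) c = trans (cong (_+_ c) (∑-const n c)) (sym (*-suc c n))

∑-single : ∀ {n} (f : Fin n → ℕ) i → (∀ j → j ≢ i → f j ≡ 0) → ∑[ j < n ] f j ≡ f i
∑-single {suc n} f i vanish = begin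
  sum f
    ≡⟨ sum-remove {i = i} f ⟩
  f i + ∑[ j < n ] f (punchIn i j)
    ≡⟨ cong (_+_ (f i)) (sum-cong-≗ (λ j → vanish _ (Fin.punchInᵢ≢i i j))) ⟩
  f i + ∑[ j < n ] 0
    ≡⟨ cong (_+_ (f i)) (∑-const n 0) ⟩
  f i + 0
    ≡⟨ +-identityʳ (f i) ⟩
  f i
    ∎
  where open ≡-Reasoning

m∸1*m≡0 : ∀ m → m ∸ 1 * m ≡ 0
m∸1*m≡0 m = trans (cong (m ∸_) (*-identityˡ m)) (n∸n≡0 m)

δℕ : ℕ → ℕ → ℕ
δℕ zero    zero    = 1
δℕ zero    (suc _) = 0
δℕ (suc _) zero    = 0
δℕ (suc e) (suc i) = δℕ e i

δℕ≤1 : ∀ e i → δℕ e i ≤ 1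
δℕ≤1 zero    zero    = ≤-refl
δℕ≤1 zero    (suc _) = z≤n
δℕ≤1 (suc _) zero    = z≤n
δℕ≤1 (suc e) (suc i) = δℕ≤1 e i

δℕ>0⇒≡ : ∀ e i → 0 < δℕ e i → e ≡ i
δℕ>0⇒≡ zero    zero    _   = refl
δℕ>0⇒≡ (suc e) (suc i) pos = cong suc (δℕ>0⇒≡ e i pos)

δℕ-*-≤ : ∀ {m} (h : ℕ → ℕ) e i → m ≤ h i → δℕ e i * m ≤ h e
δℕ-*-≤ h zero    zero    m≤hi = ≤-trans (≤-reflexive (*-identityˡ _)) m≤hi
δℕ-*-≤ h zero    (suc _) _    = z≤n
δℕ-*-≤ h (suc _) zero    _    = z≤n
δℕ-*-≤ h (suc e) (suc i) m≤hi = δℕ-*-≤ (h ∘ suc) e i m≤hi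

DepthProfile : Set
DepthProfile = ℕ → ℕ

cons : ℕ → DepthProfile → DepthProfile
cons a h zero    = a
cons a h (suc e) = h e

cons-cong : ∀ a {g h} → g ≗ h → cons a g ≗ cons a h
cons-cong a g≗h zero    = refl
cons-cong a g≗h (suc e) = g≗h e

addChip : DepthProfile → DepthProfile
addChip h = cons (suc (h 0)) (h ∘ suc)

module ChipFiring (k : ℕ) where

  V : Set
  V = Vertex k

  δ : V → V → ℕ
  δ v w = ind (w ≟V v)

  δ-self : ∀ v → δ v v ≡ 1
  δ-self v = ind-yes (v ≟V v) refl

  ind-∷ : ∀ (i : Fin k) w v → ind ((i ∷ w) ≟V (i ∷ v)) ≡ ind (w ≟V v)
  ind-∷ i w v = ind-cong ((i ∷ w) ≟V (i ∷ v)) (w ≟V v) List.∷-injectiveʳ (cong (i ∷_))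

  ∑-δ-children : ∀ v w → ∑[ j < k ] δ v (j ∷ w) ≡ isParent w v
  ∑-δ-children []      w = ∑-const k 0
  ∑-δ-children (i ∷ v) w = begin
    ∑[ j < k ] δ (i ∷ v) (j ∷ w)
      ≡⟨ ∑-single _ i (λ j j≢i → ind-no _ (j≢i ∘ List.∷-injectiveˡ)) ⟩
    ind ((i ∷ w) ≟V (i ∷ v))
      ≡⟨ ind-∷ i w v ⟩
    ind (w ≟V v)
      ≡⟨ ind-cong (w ≟V v) (v ≟V w) sym sym ⟩
    ind (v ≟V w)
      ∎
    where open ≡-Reasoning

  odometer : List V → V → ℕ
  odometer []       w = 0
  odometer (v ∷ vs) w = δ v w + odometer vs w

  odometer-++ : ∀ xs ys w → odometer (xs ++ ys) w ≡ odometer xs w + odometer ys w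
  odometer-++ []       ys w = refl
  odometer-++ (x ∷ xs) ys w =
    trans (cong (_+_ (δ x w)) (odometer-++ xs ys w)) (sym (+-assoc (δ x w) _ _))

  rootCount≡odometer : ∀ vs → rootCount vs ≡ odometer vs root
  rootCount≡odometer []             = refl
  rootCount≡odometer ([] ∷ vs)      = cong suc (rootCount≡odometer vs)
  rootCount≡odometer ((_ ∷ _) ∷ vs) = rootCount≡odometer vs

  -- Through the self-loop, the root is its own parent.
  parent : V → V
  parent []      = []
  parent (_ ∷ w) = w

  inflow : (V → ℕ) → V → ℕ
  inflow u w = ∑[ j < k ] u (j ∷ w) + u (parent w)

  inflow-cong : ∀ {u u′} → u ≗ u′ → inflow u ≗ inflow u′
  inflow-cong u≗u′ w = cong₂ _+_ (sum-cong-≗ (λ j → u≗u′ (j ∷ w))) (u≗u′ (parent w))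

  inflow-0 : ∀ w → inflow (λ _ → 0) w ≡ 0
  inflow-0 w = cong (_+ 0) (∑-const k 0)

  inflow-+ : ∀ u u′ w → inflow (λ x → u x + u′ x) w ≡ inflow u w + inflow u′ w
  inflow-+ u u′ w = trans
    (cong (_+ (u (parent w) + u′ (parent w))) (∑-distrib-+ (λ j → u (j ∷ w)) (λ j → u′ (j ∷ w))))
    (interchange (∑[ j < k ] u (j ∷ w)) (∑[ j < k ] u′ (j ∷ w)) (u (parent w)) (u′ (parent w)))

  inflow-δ : ∀ v w → inflow (δ v) w ≡ received v w
  inflow-δ []      []      = cong (_+ 1) (∑-δ-children [] [])
  inflow-δ (i ∷ v) []      = trans (cong (_+ 0) (∑-δ-children (i ∷ v) [])) (sym (+-identityʳ _))
  inflow-δ []      (j ∷ w) = trans (cong (_+ δ [] w) (∑-δ-children [] (j ∷ w))) (sym (+-identityʳ _))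
  inflow-δ (i ∷ v) (j ∷ w) =
    trans (cong (_+ δ (i ∷ v) w) (∑-δ-children (i ∷ v) (j ∷ w))) (sym (+-identityʳ _))

  fire-balance : ∀ (c : Config k) {v} → suc k ≤ c v → ∀ w →
                 fire c v w + δ v w * suc k ≡ c w + received v w
  fire-balance c {v} legal w with w ≟V v
  ... | yes refl = begin
    c w ∸ suc k + received w w + 1 * suc k
      ≡⟨ cong (_+_ (c w ∸ suc k + received w w)) (*-identityˡ (suc k)) ⟩
    c w ∸ suc k + received w w + suc k
      ≡⟨ xy∙z≈xz∙y (c w ∸ suc k) _ _ ⟩
    c w ∸ suc k + suc k + received w w
      ≡⟨ cong (_+ received w w) (m∸n+n≡m legal) ⟩
    c w + received w w
      ∎
    where open ≡-Reasoning
  ... | no _ = +-identityʳ _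

  fire-inflow : ∀ (c : Config k) {v} → suc k ≤ c v → ∀ u w →
                fire c v w + inflow u w + δ v w * suc k ≡ c w + inflow (λ x → δ v x + u x) w
  fire-inflow c {v} legal u w = begin
    fire c v w + inflow u w + δ v w * suc k ≡⟨ xy∙z≈xz∙y (fire c v w) _ _ ⟩
    fire c v w + δ v w * suc k + inflow u w ≡⟨ cong (_+ inflow u w) (fire-balance c legal w) ⟩
    c w + received v w + inflow u w         ≡⟨ +-assoc (c w) _ _ ⟩
    c w + (received v w + inflow u w)       ≡⟨ cong (λ r → c w + (r + inflow u w)) (inflow-δ v w) ⟨
    c w + (inflow (δ v) w + inflow u w)     ≡⟨ cong (_+_ (c w)) (inflow-+ (δ v) u w) ⟨
    c w + inflow (λ x → δ v x + u x) w      ∎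
    where open ≡-Reasoning

  odometer-invariant : ∀ {c vs c′} → Run c vs c′ → ∀ w →
                       c′ w + odometer vs w * suc k ≡ c w + inflow (odometer vs) w
  odometer-invariant {c} done w = cong (_+_ (c w)) (sym (inflow-0 w))
  odometer-invariant {c} {v ∷ vs} {c′} (step legal run) w = begin
    c′ w + (δ v w + odometer vs w) * suc k
      ≡⟨ cong (_+_ (c′ w)) (*-distribʳ-+ (suc k) (δ v w) _) ⟩
    c′ w + (δ v w * suc k + odometer vs w * suc k)
      ≡⟨ x∙yz≈xz∙y (c′ w) _ _ ⟩
    c′ w + odometer vs w * suc k + δ v w * suc k
      ≡⟨ cong (_+ δ v w * suc k) (odometer-invariant run w) ⟩
    fire c v w + inflow (odometer vs) w + δ v w * suc k
      ≡⟨ fire-inflow c legal (odometer vs) w ⟩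
    c w + inflow (odometer (v ∷ vs)) w
      ∎
    where open ≡-Reasoning

  -- Firing every vertex x exactly u x times would leave at most k chips everywhere.
  Stabilizing : Config k → (V → ℕ) → Set
  Stabilizing c u = ∀ w → c w + inflow u w ≤ k + u w * suc k

  odometer-stabilizing : ∀ {c vs c′} → Run c vs c′ → Stable c′ → Stabilizing c (odometer vs)
  odometer-stabilizing {vs = vs} run stable w =
    subst (_≤ k + odometer vs w * suc k) (odometer-invariant run w)
          (+-monoˡ-≤ _ (≤-pred (stable w)))

  stabilizing-fires : ∀ {c u v} → Stabilizing c u → suc k ≤ c v → 1 ≤ u v
  stabilizing-fires {c} {u} {v} stab legal = n≢0⇒n>0 λ uv≡0 → 1+n≰n (begin
    suc k            ≤⟨ legal ⟩
    c v              ≤⟨ m≤m+n (c v) _ ⟩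
    c v + inflow u v ≤⟨ stab v ⟩
    k + u v * suc k  ≡⟨ cong (λ n → k + n * suc k) uv≡0 ⟩
    k + 0            ≡⟨ +-identityʳ k ⟩
    k                ∎)
    where open ≤-Reasoning

  fire-stabilizing : ∀ {c u u′ v} → suc k ≤ c v → (∀ x → u x ≡ δ v x + u′ x) →
                     Stabilizing c u → Stabilizing (fire c v) u′
  fire-stabilizing {c} {u} {u′} {v} legal split stab w = +-cancelʳ-≤ (δ v w * suc k) _ _ (begin
    fire c v w + inflow u′ w + δ v w * suc k ≡⟨ fire-inflow c legal u′ w ⟩
    c w + inflow (λ x → δ v x + u′ x) w      ≡⟨ cong (_+_ (c w)) (inflow-cong split w) ⟨
    c w + inflow u w                         ≤⟨ stab w ⟩
    k + u w * suc k                          ≡⟨ cong (λ n → k + n * suc k) (split w) ⟩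
    k + (δ v w + u′ w) * suc k               ≡⟨ cong (_+_ k) (*-distribʳ-+ (suc k) (δ v w) (u′ w)) ⟩
    k + (δ v w * suc k + u′ w * suc k)       ≡⟨ x∙yz≈xz∙y k _ _ ⟩
    k + u′ w * suc k + δ v w * suc k         ∎)
    where open ≤-Reasoning

  leastAction : ∀ {c vs c′ u} → Run c vs c′ → Stabilizing c u → ∀ w → odometer vs w ≤ u w
  leastAction done _ w = z≤n
  leastAction {c} {v ∷ vs} {u = u} (step legal run) stab w = begin
    δ v w + odometer vs w
      ≤⟨ +-monoʳ-≤ (δ v w) (leastAction run (fire-stabilizing legal split stab) w) ⟩
    δ v w + u′ w
      ≡⟨ split w ⟨
    u w
      ∎
    where
    open ≤-Reasoning
    u′ : V → ℕ
    u′ x = u x ∸ δ v x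
    δ≤u : ∀ x → δ v x ≤ u x
    δ≤u x with x ≟V v
    ... | yes refl = stabilizing-fires {c} {u} stab legal
    ... | no _     = z≤n
    split : ∀ x → u x ≡ δ v x + u′ x
    split x = sym (m+[n∸m]≡n (δ≤u x))

  odometer-unique : ∀ {c vs c′ ws c″} → Run c vs c′ → Stable c′ →
                    Run c ws c″ → Stable c″ → ∀ w → odometer vs w ≡ odometer ws w
  odometer-unique run stable run′ stable′ w =
    ≤-antisym (leastAction run (odometer-stabilizing run′ stable′) w)
              (leastAction run′ (odometer-stabilizing run stable) w)

  Run-++ : ∀ {c : Config k} {xs c′ ys c″} → Run c xs c′ → Run c′ ys c″ → Run c (xs ++ ys) c″
  Run-++ done             run′ = run′
  Run-++ (step legal run) run′ = step legal (Run-++ run run′)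

  fire-extra : ∀ {c d e : Config k} {v} → suc k ≤ c v → (∀ w → d w ≡ c w + e w) →
               ∀ w → fire d v w ≡ fire c v w + e w
  fire-extra {c} {d} {e} {v} legal d≡c+e w with w ≟V v
  ... | yes refl = begin
    d w ∸ suc k + received w w       ≡⟨ cong (λ n → n ∸ suc k + received w w) (d≡c+e w) ⟩
    c w + e w ∸ suc k + received w w ≡⟨ cong (_+ received w w) (+-∸-comm (e w) legal) ⟩
    c w ∸ suc k + e w + received w w ≡⟨ xy∙z≈xz∙y (c w ∸ suc k) _ _ ⟩
    c w ∸ suc k + received w w + e w ∎
    where open ≡-Reasoning
  ... | no _ = trans (cong (_+ received v w) (d≡c+e w)) (xy∙z≈xz∙y (c w) _ _)

  Run-extra : ∀ {c vs c′} {d e : Config k} → Run c vs c′ → (∀ w → d w ≡ c w + e w) →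
              Σ (Config k) λ d′ → Run d vs d′ × (∀ w → d′ w ≡ c′ w + e w)
  Run-extra {d = d} done d≡c+e = d , done , d≡c+e
  Run-extra {c} {v ∷ _} {d = d} {e} (step legal run) d≡c+e
    with Run-extra run (fire-extra legal d≡c+e)
  ... | d′ , run′ , d′≡c′+e = d′ , step legal′ run′ , d′≡c′+e
    where
    legal′ : suc k ≤ d v
    legal′ = ≤-trans legal (≤-trans (m≤m+n (c v) (e v)) (≤-reflexive (sym (d≡c+e v))))

  run-distinct : ∀ (c : Config k) L → (∀ v → odometer L v ≤ 1) →
                 (∀ v → 0 < odometer L v → suc k ≤ c v) → Σ (Config k) (Run c L)
  run-distinct c []      _    _      = c , done
  run-distinct c (v ∷ L) once loaded =
    _ , step (loaded v (≤-trans (≤-reflexive (sym (δ-self v))) (m≤m+n _ _)))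
             (proj₂ (run-distinct (fire c v) L once′ loaded′))
    where
    once′ : ∀ x → odometer L x ≤ 1
    once′ x = ≤-trans (m≤n+m _ (δ v x)) (once x)
    loaded′ : ∀ x → 0 < odometer L x → suc k ≤ fire c v x
    loaded′ x pos with x ≟V v | once x | loaded x
    ... | yes refl | s≤s once-x | _        = contradiction once-x (<⇒≱ pos)
    ... | no _     | _          | loaded-x = ≤-trans (loaded-x pos) (m≤m+n (c x) (received v x))

  children : V → List V
  children v = tabulate (_∷ v)

  odometer-tabulate : ∀ {n} (f : Fin n → V) w → odometer (tabulate f) w ≡ ∑[ j < n ] δ (f j) w
  odometer-tabulate {zero}  f w = refl
  odometer-tabulate {suc n} f w = cong (_+_ (δ (f fzero) w)) (odometer-tabulate (f ∘ fsuc) w)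

  odometer-children : ∀ v j w → odometer (children v) (j ∷ w) ≡ δ v w
  odometer-children v j w = begin
    odometer (children v) (j ∷ w)
      ≡⟨ odometer-tabulate (_∷ v) (j ∷ w) ⟩
    ∑[ i < k ] δ (i ∷ v) (j ∷ w)
      ≡⟨ ∑-single _ j (λ i i≢j → ind-no _ (i≢j ∘ sym ∘ List.∷-injectiveˡ)) ⟩
    ind ((j ∷ w) ≟V (j ∷ v))
      ≡⟨ ind-∷ j w v ⟩
    δ v w
      ∎
    where open ≡-Reasoning

  odometer-children-root : ∀ v → odometer (children v) root ≡ 0
  odometer-children-root v = trans (odometer-tabulate (_∷ v) root) (∑-const k 0)

  odometer-concatMap-children : ∀ L j w → odometer (concatMap children L) (j ∷ w) ≡ odometer L w
  odometer-concatMap-children []      j w = refl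
  odometer-concatMap-children (v ∷ L) j w =
    trans (odometer-++ (children v) _ (j ∷ w))
          (cong₂ _+_ (odometer-children v j w) (odometer-concatMap-children L j w))

  odometer-concatMap-children-root : ∀ L → odometer (concatMap children L) root ≡ 0
  odometer-concatMap-children-root []      = refl
  odometer-concatMap-children-root (v ∷ L) =
    trans (odometer-++ (children v) _ root)
          (cong₂ _+_ (odometer-children-root v) (odometer-concatMap-children-root L))

  level : ℕ → List V
  level zero    = root ∷ []
  level (suc i) = concatMap children (level i)

  odometer-level : ∀ i w → odometer (level i) w ≡ δℕ (length w) i
  odometer-level zero    []      = refl
  odometer-level zero    (_ ∷ _) = refl
  odometer-level (suc i) []      = odometer-concatMap-children-root (level i)
  odometer-level (suc i) (j ∷ w) =
    trans (odometer-concatMap-children (level i) j w) (odometer-level i w)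

  -- Chips received by each vertex of depth e when all of depth i fires:
  -- k from its children, 1 from its parent and, at the root, 1 from the self-loop.
  levelInflow : ℕ → ℕ → ℕ
  levelInflow i e = δℕ (suc e) i * k + δℕ e (suc i) + δℕ 0 (i + e)

  levelFire : DepthProfile → ℕ → DepthProfile
  levelFire h i e = levelInflow i e + (h e ∸ δℕ e i * suc k)

  levelFire-cong : ∀ {g h} → g ≗ h → ∀ i → levelFire g i ≗ levelFire h i
  levelFire-cong g≗h i e = cong (λ n → levelInflow i e + (n ∸ δℕ e i * suc k)) (g≗h e)

  levelFire-balance : ∀ {h i} → suc k ≤ h i → ∀ e →
                      levelFire h i e + δℕ e i * suc k ≡ h e + levelInflow i e
  levelFire-balance {h} {i} legal e = begin
    levelInflow i e + (h e ∸ δℕ e i * suc k) + δℕ e i * suc k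
      ≡⟨ +-assoc (levelInflow i e) _ _ ⟩
    levelInflow i e + (h e ∸ δℕ e i * suc k + δℕ e i * suc k)
      ≡⟨ cong (_+_ (levelInflow i e)) (m∸n+n≡m (δℕ-*-≤ h e i legal)) ⟩
    levelInflow i e + h e
      ≡⟨ +-comm (levelInflow i e) (h e) ⟩
    h e + levelInflow i e
      ∎
    where open ≡-Reasoning

  inflow-depth : ∀ i w → inflow (λ x → δℕ (length x) i) w ≡ levelInflow i (length w)
  inflow-depth zero    []      = cong (_+ 1) (∑-const k 0)
  inflow-depth (suc i) []      = cong (_+ 0) (trans (∑-const k _) (sym (+-identityʳ _)))
  inflow-depth zero    (_ ∷ w) =
    trans (cong (_+ δℕ (length w) 0) (∑-const k _)) (sym (+-identityʳ _))
  inflow-depth (suc i) (_ ∷ w) =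
    trans (cong (_+ δℕ (length w) (suc i)) (∑-const k _)) (sym (+-identityʳ _))

  levelRun : ∀ {h i} → suc k ≤ h i → (c : Config k) → c ≗ h ∘ length →
             Σ (Config k) λ c′ → Run c (level i) c′ × c′ ≗ levelFire h i ∘ length
  levelRun {h} {i} legal c c≗h with run-distinct c (level i) once loaded
    where
    once : ∀ v → odometer (level i) v ≤ 1
    once v = subst (_≤ 1) (sym (odometer-level i v)) (δℕ≤1 (length v) i)
    loaded : ∀ v → 0 < odometer (level i) v → suc k ≤ c v
    loaded v pos = subst (suc k ≤_) (sym (trans (c≗h v) (cong h depth))) legal
      where
      depth : length v ≡ i
      depth = δℕ>0⇒≡ _ _ (subst (0 <_) (odometer-level i v) pos)
  ... | c′ , run = c′ , run , λ w → +-cancelʳ-≡ _ _ _ (begin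
    c′ w + δℕ (length w) i * suc k
      ≡⟨ cong (λ n → c′ w + n * suc k) (odometer-level i w) ⟨
    c′ w + odometer (level i) w * suc k
      ≡⟨ odometer-invariant run w ⟩
    c w + inflow (odometer (level i)) w
      ≡⟨ cong₂ _+_ (c≗h w) (inflow-cong (odometer-level i) w) ⟩
    h (length w) + inflow (λ x → δℕ (length x) i) w
      ≡⟨ cong (_+_ (h (length w))) (inflow-depth i w) ⟩
    h (length w) + levelInflow i (length w)
      ≡⟨ levelFire-balance legal (length w) ⟨
    levelFire h i (length w) + δℕ (length w) i * suc k
      ∎)
    where open ≡-Reasoning

  -- Firings of whole levels, seen on depth profiles; the index counts root firings.
  data LevelRun : DepthProfile → ℕ → DepthProfile → Set where
    halt      : ∀ {h h′} → h ≗ h′ → LevelRun h 0 h′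
    fireLevel : ∀ {h i r h′} → suc k ≤ h i → LevelRun (levelFire h i) r h′ →
                LevelRun h (δℕ 0 i + r) h′

  LevelRun-resp : ∀ {g h r h′} → g ≗ h → LevelRun h r h′ → LevelRun g r h′
  LevelRun-resp g≗h (halt h≗h′)                   = halt (λ e → trans (g≗h e) (h≗h′ e))
  LevelRun-resp g≗h (fireLevel {i = i} legal run) =
    fireLevel (≤-trans legal (≤-reflexive (sym (g≗h i)))) (LevelRun-resp (levelFire-cong g≗h i) run)

  treeRun : ∀ {h r h′} → LevelRun h r h′ → (c : Config k) → c ≗ h ∘ length →
            Σ (List V) λ vs → Σ (Config k) λ c′ →
              Run c vs c′ × c′ ≗ h′ ∘ length × odometer vs root ≡ r
  treeRun (halt h≗h′) c c≗h = [] , c , done , (λ w → trans (c≗h w) (h≗h′ (length w))) , refl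
  treeRun (fireLevel {i = i} legal lrun) c c≗h with levelRun legal c c≗h
  ... | c₁ , run₁ , c₁≗ with treeRun lrun c₁ c₁≗
  ... | vs , c₂ , run₂ , c₂≗ , count =
    level i ++ vs , c₂ , Run-++ run₁ run₂ , c₂≗ ,
    trans (odometer-++ (level i) vs root) (cong₂ _+_ (odometer-level i root) count)

  levelFire-full-root : ∀ g → levelFire (cons (suc k) g) 0 ≗ cons 1 (addChip g)
  levelFire-full-root g zero          = cong suc (m∸1*m≡0 (suc k))
  levelFire-full-root g (suc zero)    = refl
  levelFire-full-root g (suc (suc e)) = refl

  levelFire-cons : ∀ a g i → levelFire (cons a g) (suc (suc i)) ≗ cons a (levelFire g (suc i))
  levelFire-cons a g i zero    = refl
  levelFire-cons a g i (suc e) = refl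

  levelFire-parent : ∀ g → levelFire (cons 1 g) 1 0 ≡ suc k
  levelFire-parent g =
    trans (cong (_+ 1) (trans (+-identityʳ _) (trans (+-identityʳ _) (*-identityˡ k)))) (+-comm k 1)

  levelFire-relay : ∀ g → levelFire (levelFire (cons 1 g) 1) 0 ≗ cons 1 (levelFire g 0)
  levelFire-relay g zero                =
    cong suc (trans (cong (_∸ 1 * suc k) (levelFire-parent g)) (m∸1*m≡0 (suc k)))
  levelFire-relay g (suc zero)          = refl
  levelFire-relay g (suc (suc zero))    = refl
  levelFire-relay g (suc (suc (suc e))) = refl

  -- Pushing a level run one level deeper, below a root holding one chip: each
  -- root firing becomes a firing of depth 1, which refills the root to k + 1.
  shift : ∀ {g r g′} → LevelRun g r g′ → LevelRun (cons 1 g) r (cons 1 g′)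
  shift (halt g≗g′) = halt (cons-cong 1 g≗g′)
  shift {g} (fireLevel {i = zero} legal run) =
    fireLevel {i = 1} legal
      (fireLevel {i = 0} (≤-reflexive (sym (levelFire-parent g)))
        (LevelRun-resp (levelFire-relay g) (shift run)))
  shift {g} (fireLevel {i = suc i} legal run) =
    fireLevel {i = suc (suc i)} legal (LevelRun-resp (levelFire-cons 1 g i) (shift run))

  addChip-depth : ∀ {c d : Config k} {h} → c ≗ h ∘ length → (∀ w → d w ≡ c w + initial 1 w) →
                  d ≗ addChip h ∘ length
  addChip-depth c≗h d≡c+1 []      = trans (d≡c+1 []) (trans (cong (_+ 1) (c≗h [])) (+-comm _ 1))
  addChip-depth c≗h d≡c+1 (j ∷ w) = trans (d≡c+1 (j ∷ w)) (trans (+-identityʳ _) (c≗h (j ∷ w)))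

initial-suc : ∀ {k} N (w : Vertex k) → initial (suc N) w ≡ initial N w + initial 1 w
initial-suc N []      = +-comm 1 N
initial-suc N (_ ∷ _) = refl

-- digits n = d₀ ∷ d₁ ∷ … with every dₑ in 1..k and n = Σ dₑ kᵉ.
module BijectiveDigits (k′ : ℕ) where

  k : ℕ
  k = suc k′

  open ChipFiring k

  increment : List ℕ → List ℕ
  increment []       = 1 ∷ []
  increment (d ∷ ds) with d ≟ k
  ... | yes _ = 1 ∷ increment ds
  ... | no _  = suc d ∷ ds

  carries : List ℕ → ℕ
  carries []       = 0
  carries (d ∷ ds) with d ≟ k
  ... | yes _ = suc (carries ds)
  ... | no _  = 0

  digits : ℕ → List ℕ
  digits zero    = []
  digits (suc n) = increment (digits n)

  profile : List ℕ → DepthProfile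
  profile []       = λ _ → 0
  profile (d ∷ ds) = cons d (profile ds)

  f₀ : ℕ → ℕ
  f₀ zero    = 0
  f₀ (suc n) = f₀ n + carries (digits n)

  addChip-levelRun : ∀ ds → LevelRun (addChip (profile ds)) (carries ds) (profile (increment ds))
  addChip-levelRun []       = halt (λ _ → refl)
  addChip-levelRun (d ∷ ds) with d ≟ k
  ... | yes refl = fireLevel {i = 0} ≤-refl
                     (LevelRun-resp (levelFire-full-root (profile ds)) (shift (addChip-levelRun ds)))
  ... | no _     = halt (λ _ → refl)

  increment-≤ : ∀ {ds} → All (_≤ k) ds → All (_≤ k) (increment ds)
  increment-≤ []                   = s≤s z≤n ∷ []
  increment-≤ {d ∷ ds} (d≤k ∷ ds≤k) with d ≟ k
  ... | yes _  = s≤s z≤n ∷ increment-≤ ds≤k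
  ... | no d≢k = ≤∧≢⇒< d≤k d≢k ∷ ds≤k

  digits-≤ : ∀ n → All (_≤ k) (digits n)
  digits-≤ zero    = []
  digits-≤ (suc n) = increment-≤ (digits-≤ n)

  profile-≤ : ∀ {ds} → All (_≤ k) ds → ∀ e → profile ds e ≤ k
  profile-≤ []         e       = z≤n
  profile-≤ (d≤k ∷ _)  zero    = d≤k
  profile-≤ (_ ∷ ds≤k) (suc e) = profile-≤ ds≤k e

  stabilization : ∀ N → Σ (List V) λ vs → Σ (Config k) λ c →
                    Run (initial N) vs c × c ≗ profile (digits N) ∘ length × odometer vs root ≡ f₀ N
  stabilization zero = [] , initial 0 , done , empty , refl
    where
    empty : initial 0 ≗ (λ _ → 0) ∘ length
    empty []      = refl
    empty (_ ∷ _) = refl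
  stabilization (suc N) with stabilization N
  ... | vs , c , run , c≗ , count with Run-extra run (initial-suc N)
  ... | d , run′ , d≡c+1
    with treeRun (addChip-levelRun (digits N)) d (addChip-depth {h = profile (digits N)} c≗ d≡c+1)
  ... | ws , c′ , run″ , c′≗ , count′ =
    vs ++ ws , c′ , Run-++ run′ run″ , c′≗ ,
    trans (odometer-++ vs ws root) (cong₂ _+_ count count′)

  rootFires≡f₀ : ∀ {N a} → RootFires k N a → a ≡ f₀ N
  rootFires≡f₀ {N} {a} (vs , c , run , stable , count) with stabilization N
  ... | ws , c′ , run′ , c′≗ , count′ = begin
    a                ≡⟨ count ⟨
    rootCount vs     ≡⟨ rootCount≡odometer vs ⟩
    odometer vs root ≡⟨ odometer-unique run stable run′ stable′ root ⟩
    odometer ws root ≡⟨ count′ ⟩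
    f₀ N             ∎
    where
    open ≡-Reasoning
    stable′ : Stable c′
    stable′ w = s≤s (subst (_≤ k) (sym (c′≗ w)) (profile-≤ (digits-≤ N) (length w)))

  increment-max : ∀ ds → increment (k ∷ ds) ≡ 1 ∷ increment ds
  increment-max ds with k ≟ k
  ... | yes _  = refl
  ... | no k≢k = contradiction refl k≢k

  increment-< : ∀ {d} ds → d < k → increment (d ∷ ds) ≡ suc d ∷ ds
  increment-< {d} ds d<k with d ≟ k
  ... | yes d≡k = contradiction d≡k (<⇒≢ d<k)
  ... | no _    = refl

  carries-max : ∀ ds → carries (k ∷ ds) ≡ suc (carries ds)
  carries-max ds with k ≟ k
  ... | yes _  = refl
  ... | no k≢k = contradiction refl k≢k

  carries-< : ∀ {d} ds → d < k → carries (d ∷ ds) ≡ 0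
  carries-< {d} ds d<k with d ≟ k
  ... | yes d≡k = contradiction d≡k (<⇒≢ d<k)
  ... | no _    = refl

  digits[1+r+q*k] : ∀ q r → r < k → digits (suc r + q * k) ≡ suc r ∷ digits q
  digits[1+r+q*k] zero    zero    _   = refl
  digits[1+r+q*k] (suc q) zero    _   =
    trans (cong increment (digits[1+r+q*k] q k′ ≤-refl)) (increment-max (digits q))
  digits[1+r+q*k] q       (suc r) r<k =
    trans (cong increment (digits[1+r+q*k] q r (<-trans (n<1+n r) r<k))) (increment-< (digits q) r<k)

  f₀[1+r+q*k] : ∀ q r → r < k → f₀ (suc r + q * k) ≡ f₀ (suc (q * k))
  f₀[1+r+q*k] q zero    _   = refl
  f₀[1+r+q*k] q (suc r) r<k = begin
    f₀ (suc r + q * k) + carries (digits (suc r + q * k))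
      ≡⟨ cong₂ _+_ (f₀[1+r+q*k] q r r<k′) (cong carries (digits[1+r+q*k] q r r<k′)) ⟩
    f₀ (suc (q * k)) + carries (suc r ∷ digits q)
      ≡⟨ cong (_+_ (f₀ (suc (q * k)))) (carries-< (digits q) r<k) ⟩
    f₀ (suc (q * k)) + 0
      ≡⟨ +-identityʳ _ ⟩
    f₀ (suc (q * k))
      ∎
    where
    open ≡-Reasoning
    r<k′ : r < k
    r<k′ = <-trans (n<1+n r) r<k

  carries-digits-multiple : ∀ q → carries (digits (suc q * k)) ≡ suc (carries (digits q))
  carries-digits-multiple q =
    trans (cong carries (digits[1+r+q*k] q k′ ≤-refl)) (carries-max (digits q))

  carries-digits-nonmultiple : ∀ n → ¬ k ∣ n → carries (digits n) ≡ 0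
  carries-digits-nonmultiple n k∤n with n % k in n%k | m%n<n n k
  ... | zero  | _   = contradiction (m%n≡0⇒n∣m n k n%k) k∤n
  ... | suc r | r<k = begin
    carries (digits n)
      ≡⟨ cong (carries ∘ digits) (trans (m≡m%n+[m/n]*n n k) (cong (_+ n / k * k) n%k)) ⟩
    carries (digits (suc r + n / k * k))
      ≡⟨ cong carries (digits[1+r+q*k] (n / k) r (<-trans (n<1+n r) r<k)) ⟩
    carries (suc r ∷ digits (n / k))
      ≡⟨ carries-< (digits (n / k)) r<k ⟩
    0 ∎
    where open ≡-Reasoning

  rootFires-difference : ∀ m {a b} → RootFires k (suc m * k) a → RootFires k (m * k) b →
                         a ⊖ b ≡ + carries (digits (m * k))
  rootFires-difference m {a} {b} fa fb = begin
    a ⊖ b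
      ≡⟨ cong₂ _⊖_ (rootFires≡f₀ fa) (rootFires≡f₀ fb) ⟩
    f₀ (suc k′ + m * k) ⊖ f₀ (m * k)
      ≡⟨ cong (_⊖ f₀ (m * k)) (f₀[1+r+q*k] m k′ ≤-refl) ⟩
    f₀ (m * k) + carries (digits (m * k)) ⊖ f₀ (m * k)
      ≡⟨ ℤ.⊖-≥ (m≤m+n (f₀ (m * k)) _) ⟩
    + (f₀ (m * k) + carries (digits (m * k)) ∸ f₀ (m * k))
      ≡⟨ cong +_ (m+n∸m≡n (f₀ (m * k)) _) ⟩
    + carries (digits (m * k))
      ∎
    where open ≡-Reasoning

mainTheorem8 : (k : ℕ) → 2 ≤ k → (m : ℕ) → 1 ≤ m →
    (a b : ℕ) → RootFires k (suc m * k) a → RootFires k (m * k) b →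
    ((k ∣ m ∸ 1) →
      (j : ℕ) → m ∸ 1 ≡ j * k →
      (c d : ℕ) → RootFires k (suc j * k) c → RootFires k (j * k) d →
      a ⊖ b ≡ (c ⊖ d) +ℤ + 1)
    × (¬ (k ∣ m ∸ 1) → a ⊖ b ≡ + 1)
mainTheorem8 (suc (suc k″)) (s≤s (s≤s z≤n)) (suc m) (s≤s z≤n) a b fa fb =
    (λ _ j m≡jk c d fc fd → begin
      a ⊖ b                              ≡⟨ a-b ⟩
      + suc (carries (digits m))         ≡⟨ cong (λ n → + suc (carries (digits n))) m≡jk ⟩
      + suc (carries (digits (j * k)))   ≡⟨ cong +_ (+-comm 1 _) ⟩
      + carries (digits (j * k)) +ℤ + 1  ≡⟨ cong (_+ℤ + 1) (rootFires-difference j fc fd) ⟨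
      (c ⊖ d) +ℤ + 1                     ∎)
  , (λ k∤m → trans a-b (cong (λ n → + suc n) (carries-digits-nonmultiple m k∤m)))
  where
  open BijectiveDigits (suc k″)
  open ≡-Reasoning
  a-b : a ⊖ b ≡ + suc (carries (digits m))
  a-b = trans (rootFires-difference (suc m) fa fb) (cong +_ (carries-digits-multiple m))
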